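{- For every integer $n\geq 7$, the girth of the Fibonacci-sum graph $G_n$ (the length of a shortest cycle) is $4$.
   Context: The Fibonacci numbers are defined by $F_0=0$, $F_1=1$ and $F_m=F_{m-1}+F_{m-2}$ for $m\geq 2$. For each integer $n\geq 1$, the Fibonacci-sum graph $G_n$ is the simple graph with vertex set $\{1,2,\dots,n\}$ in which distinct vertices $i,j$ are adjacent if and only if $i+j$ is a Fibonacci number. -}

module Defs where

open import Data.Nat using (ℕ; zero; suc; _+_; _≤_; _<_)
open import Data.Fin using (Fin; toℕ; fromℕ<)
open import Data.Nat.DivMod using (_%_; m%n<n)
open import Data.Product using (Σ; ∃; _×_)
open import Relation.Binary.PropositionalEquality using (_≡_; _≢_)
open import Function.Definitions using (Injective)

fib : ℕ → ℕ
fib zero = 0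
fib (suc zero) = 1
fib (suc (suc m)) = fib (suc m) + fib m

IsFib : ℕ → Set
IsFib k = ∃ λ m → fib m ≡ k

Vertex : ℕ → ℕ → Set
Vertex n i = 1 ≤ i × i ≤ n

Adj : ℕ → ℕ → ℕ → Set
Adj n i j = Vertex n i × Vertex n j × i ≢ j × IsFib (i + j)

next : {k : ℕ} → Fin (suc k) → Fin (suc k)
next {k} i = fromℕ< (m%n<n (suc (toℕ i)) (suc k))

record Cycle3+ (n m : ℕ) : Set where
  field
    vertices : Fin (3 + m) → ℕ
    distinct : Injective _≡_ _≡_ vertices
    adjacent : ∀ i → Adj n (vertices i) (vertices (next i))

HasCycle : ℕ → ℕ → Set
HasCycle n k = Σ ℕ λ m → (k ≡ 3 + m) × Cycle3+ n m

Girth≡ : ℕ → ℕ → Set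
Girth≡ n g = HasCycle n g × (∀ k → HasCycle n k → g ≤ k)

module Submission where

-- Upper bound: 1 – 2 – 6 – 7 – 1 is a 4-cycle of G n as soon as n ≥ 7,
-- since the consecutive sums 3, 8, 13, 8 are Fibonacci numbers.
--
-- Lower bound: cycles have length at least 3 by definition, so it suffices
-- to show that G n is triangle-free.  If 1 ≤ a < b < c had all three pairwise
-- sums Fibonacci, say a + b = F i, a + c = F j, b + c = F k, then
-- F i < F j < F k forces i < j < k, and the Fibonacci recursion gives
-- F i + F j ≤ F k, i.e. 2a + b + c ≤ b + c, contradicting a ≥ 1.

open import Defs
open import Data.Nat using (ℕ; zero; suc; _+_; _≤_; _<_; _≤′_; ≤′-refl; ≤′-step; _<?_; _≤ᵇ_; z≤n; s≤s)
open import Data.Nat.Properties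
open import Data.Fin using (Fin)
import Data.Fin as F
open import Data.Product using (_,_)
open import Data.Empty using (⊥; ⊥-elim)
open import Data.Unit using (tt)
open import Data.Bool using (T)
open import Relation.Nullary using (yes; no)
open import Relation.Binary using (tri<; tri≈; tri>)
open import Relation.Binary.PropositionalEquality

fib-≤-suc : ∀ n → fib n ≤ fib (suc n)
fib-≤-suc zero          = z≤n
fib-≤-suc (suc zero)    = s≤s z≤n
fib-≤-suc (suc (suc m)) = m≤m+n _ _

fib-mono′ : ∀ {i j} → i ≤′ j → fib i ≤ fib j
fib-mono′ ≤′-refl            = ≤-refl
fib-mono′ (≤′-step {j} i≤′j) = ≤-trans (fib-mono′ i≤′j) (fib-≤-suc j)

fib-mono : ∀ {i j} → i ≤ j → fib i ≤ fib j
fib-mono i≤j = fib-mono′ (≤⇒≤′ i≤j)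

fib-reflects-< : ∀ i j → fib i < fib j → i < j
fib-reflects-< i j fi<fj with i <? j
... | yes i<j = i<j
... | no  i≮j = ⊥-elim (<⇒≱ fi<fj (fib-mono (≮⇒≥ i≮j)))

-- The sum of two Fibonacci numbers with smaller, distinct indices is at most
-- a later one: from i < j < k we get i ≤ k - 2 and j ≤ k - 1.
fib-sum-≤ : ∀ {i j k} → i < j → j < k → fib i + fib j ≤ fib k
fib-sum-≤ {i} {suc j} {suc (suc k)} (s≤s i≤j) (s≤s (s≤s j≤k)) = begin
  fib i + fib (suc j)      ≤⟨ +-mono-≤ (fib-mono (≤-trans i≤j j≤k)) (fib-mono (s≤s j≤k)) ⟩
  fib k + fib (suc k)      ≡⟨ +-comm (fib k) (fib (suc k)) ⟩
  fib (suc (suc k))        ∎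
  where open ≤-Reasoning

isFib-+-comm : ∀ x y → IsFib (x + y) → IsFib (y + x)
isFib-+-comm x y (m , fm≡x+y) = m , trans fm≡x+y (+-comm x y)

no-sorted-fib-triangle : ∀ a b c → 1 ≤ a → a < b → b < c →
  IsFib (a + b) → IsFib (a + c) → IsFib (b + c) → ⊥
no-sorted-fib-triangle a b c 1≤a a<b b<c (i , fi≡a+b) (j , fj≡a+c) (k , fk≡b+c) =
  <⇒≱ sums-exceed sums-bounded
  where
  fi<fj : fib i < fib j
  fi<fj = subst₂ _<_ (sym fi≡a+b) (sym fj≡a+c) (+-monoʳ-< a b<c)
  fj<fk : fib j < fib k
  fj<fk = subst₂ _<_ (sym fj≡a+c) (sym fk≡b+c) (+-monoˡ-< c a<b)
  sums-bounded : (a + b) + (a + c) ≤ b + c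
  sums-bounded = subst₂ (λ x y → x + y ≤ b + c) fi≡a+b fj≡a+c
    (subst (fib i + fib j ≤_) fk≡b+c
      (fib-sum-≤ (fib-reflects-< i j fi<fj) (fib-reflects-< j k fj<fk)))
  sums-exceed : b + c < (a + b) + (a + c)
  sums-exceed = +-mono-≤-< (m≤n+m b a) (+-monoˡ-≤ c 1≤a)

no-fib-triangle : ∀ a b c → 1 ≤ a → 1 ≤ b → 1 ≤ c → a ≢ b → b ≢ c → c ≢ a →
  IsFib (a + b) → IsFib (b + c) → IsFib (c + a) → ⊥
no-fib-triangle a b c 1≤a 1≤b 1≤c a≢b b≢c c≢a ab bc ca
  with <-cmp a b | <-cmp b c | <-cmp a c
... | tri≈ _ a≡b _ | _ | _ = a≢b a≡b
... | _ | tri≈ _ b≡c _ | _ = b≢c b≡c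
... | _ | _ | tri≈ _ a≡c _ = c≢a (sym a≡c)
... | tri< a<b _ _ | tri< b<c _ _ | _ =
  no-sorted-fib-triangle a b c 1≤a a<b b<c ab (isFib-+-comm c a ca) bc
... | tri< _ _ _ | tri> _ _ c<b | tri< a<c _ _ =
  no-sorted-fib-triangle a c b 1≤a a<c c<b (isFib-+-comm c a ca) ab (isFib-+-comm b c bc)
... | tri< a<b _ _ | tri> _ _ _ | tri> _ _ c<a =
  no-sorted-fib-triangle c a b 1≤c c<a a<b ca (isFib-+-comm b c bc) ab
... | tri> _ _ b<a | tri< _ _ _ | tri< a<c _ _ =
  no-sorted-fib-triangle b a c 1≤b b<a a<c (isFib-+-comm a b ab) bc (isFib-+-comm c a ca)
... | tri> _ _ _ | tri< b<c _ _ | tri> _ _ c<a =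
  no-sorted-fib-triangle b c a 1≤b b<c c<a bc (isFib-+-comm a b ab) ca
... | tri> _ _ b<a | tri> _ _ c<b | _ =
  no-sorted-fib-triangle c b a 1≤c c<b b<a (isFib-+-comm b c bc) ca (isFib-+-comm a b ab)

no-3-cycle : ∀ n → Cycle3+ n 0 → ⊥
no-3-cycle n cycle
  with adjacent F.zero | adjacent (F.suc F.zero) | adjacent (F.suc (F.suc F.zero))
  where open Cycle3+ cycle
... | (1≤a , _) , (1≤b , _) , a≢b , ab | _ , (1≤c , _) , b≢c , bc | _ , _ , c≢a , ca =
  no-fib-triangle _ _ _ 1≤a 1≤b 1≤c a≢b b≢c c≢a ab bc ca

square : Fin 4 → ℕ
square F.zero                         = 1
square (F.suc F.zero)                 = 2
square (F.suc (F.suc F.zero))         = 6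
square (F.suc (F.suc (F.suc F.zero))) = 7

square-index : ℕ → Fin 4
square-index 1 = F.zero
square-index 2 = F.suc F.zero
square-index 6 = F.suc (F.suc F.zero)
square-index _ = F.suc (F.suc (F.suc F.zero))

square-index-square : ∀ i → square-index (square i) ≡ i
square-index-square F.zero                         = refl
square-index-square (F.suc F.zero)                 = refl
square-index-square (F.suc (F.suc F.zero))         = refl
square-index-square (F.suc (F.suc (F.suc F.zero))) = refl

square-injective : ∀ {i j} → square i ≡ square j → i ≡ j
square-injective {i} {j} eq = begin
  i                         ≡⟨ sym (square-index-square i) ⟩
  square-index (square i)   ≡⟨ cong square-index eq ⟩
  square-index (square j)   ≡⟨ square-index-square j ⟩
  j                         ∎
  where open ≡-Reasoning

vertex-≤7 : ∀ {n} i → T (1 ≤ᵇ i) → T (i ≤ᵇ 7) → 7 ≤ n → Vertex n i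
vertex-≤7 i 1≤ᵇi i≤ᵇ7 7≤n = ≤ᵇ⇒≤ 1 i 1≤ᵇi , ≤-trans (≤ᵇ⇒≤ i 7 i≤ᵇ7) 7≤n

square-vertex : ∀ {n} → 7 ≤ n → ∀ i → Vertex n (square i)
square-vertex 7≤n F.zero                         = vertex-≤7 1 tt tt 7≤n
square-vertex 7≤n (F.suc F.zero)                 = vertex-≤7 2 tt tt 7≤n
square-vertex 7≤n (F.suc (F.suc F.zero))         = vertex-≤7 6 tt tt 7≤n
square-vertex 7≤n (F.suc (F.suc (F.suc F.zero))) = vertex-≤7 7 tt tt 7≤n

-- Consecutive corners are distinct and sum to 3 = F 4, 8 = F 6, 13 = F 7, 8 = F 6.
square-cycle : ∀ n → 7 ≤ n → Cycle3+ n 1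
square-cycle n 7≤n = record
  { vertices = square ; distinct = square-injective ; adjacent = edge }
  where
  corner : ∀ i → Vertex n (square i)
  corner = square-vertex 7≤n
  edge : ∀ i → Adj n (square i) (square (next i))
  edge i@F.zero                         = corner i , corner (next i) , (λ ()) , (4 , refl)
  edge i@(F.suc F.zero)                 = corner i , corner (next i) , (λ ()) , (6 , refl)
  edge i@(F.suc (F.suc F.zero))         = corner i , corner (next i) , (λ ()) , (7 , refl)
  edge i@(F.suc (F.suc (F.suc F.zero))) = corner i , corner (next i) , (λ ()) , (6 , refl)

corollary5 : ∀ (n : ℕ) → 7 ≤ n → Girth≡ n 4
corollary5 n 7≤n = (1 , refl , square-cycle n 7≤n) , shortest
  where
  shortest : ∀ k → HasCycle n k → 4 ≤ k
  shortest k (zero  , _    , triangle) = ⊥-elim (no-3-cycle n triangle)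
  shortest k (suc m , refl , _)        = s≤s (s≤s (s≤s (s≤s z≤n)))
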